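{- Let $m\ge1$ and $n\ge0$. In the Tamari order on binary trees of size $nm$, the upper ideal generated by the comb-$(n,m)$, i.e. the set of trees $T$ with $T\ge$ comb-$(n,m)$, is exactly the set of $m$-binary trees of size $nm$.
   Context: A binary tree is empty or a root with ordered (left, right) subtrees; size = number of nodes. Tamari order: $T\le T'$ iff $T'$ is obtained from $T$ by right rotations, replacing a subtree $y(x(A,B),C)$ by $x(A,y(B,C))$. The left branch of a tree is the sequence of nodes from the root following left children. The comb-$(n,m)$ is the binary tree of size $nm$ with $n$ nodes on its left branch, the right subtree of each of these nodes being a chain of $m-1$ nodes each of which is the right child of the previous one (no left children). $m$-binary trees are defined recursively: the empty tree is $m$-binary; given $m$-binary trees $T_L,T_{R_1},\dots,T_{R_m}$ and $m$ new nodes $r_1,\dots,r_m$, the following tree is $m$-binary: $r_1$ is the root with left subtree $T_L$; for $1\le i<m$, the right subtree of $r_i$ is $T_{R_i}$ with $r_{i+1}$ grafted as the left child of the leftmost node of $T_{R_i}$ (if $T_{R_i}$ is empty, $r_{i+1}$ is the right child of $r_i$); the right subtree of $r_m$ is $T_{R_m}$. -}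

module Defs where

open import Data.Nat using (ℕ; zero; suc; _+_; _∸_)
open import Data.Vec using (Vec; []; _∷_)
open import Data.Vec.Relation.Unary.All using (All)
open import Relation.Binary.Construct.Closure.ReflexiveTransitive using (Star)

data Tree : Set where
  leaf : Tree
  node : Tree → Tree → Tree

size : Tree → ℕ
size leaf       = zero
size (node l r) = suc (size l + size r)

data _⟶_ : Tree → Tree → Set where
  rot   : ∀ A B C → node (node A B) C ⟶ node A (node B C)
  left  : ∀ {l l′} r → l ⟶ l′ → node l r ⟶ node l′ r
  right : ∀ l {r r′} → r ⟶ r′ → node l r ⟶ node l r′

_≤T_ : Tree → Tree → Set
_≤T_ = Star _⟶_

chain : ℕ → Tree
chain zero    = leaf
chain (suc k) = node leaf (chain k)

comb : ℕ → ℕ → Tree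
comb zero    m = leaf
comb (suc n) m = node (comb n m) (chain (m ∸ 1))

-- graft S T: T with S grafted as the left child of the leftmost node of T;
-- if T is empty, the result is S itself (so S becomes the right child of the
-- node whose right subtree T was).
graft : Tree → Tree → Tree
graft S leaf       = S
graft S (node l r) = node (graft S l) r

-- build L (R₁ ∷ … ∷ Rₘ): the tree with new nodes r₁,…,rₘ as in the definition of
-- m-binary trees: r₁ is the root with left subtree L; the right subtree of rᵢ
-- (i<m) is Rᵢ with rᵢ₊₁ grafted at its leftmost node; the right subtree of rₘ is Rₘ.
-- (rᵢ for i ≥ 2 have empty left subtree before grafting.)
-- The m = 0 clause is never used (m ≥ 1 in the definition).
build : ∀ {m} → Tree → Vec Tree m → Tree
build L []            = L
build L (R ∷ [])      = node L R
build L (R ∷ R′ ∷ Rs) = node L (graft (build leaf (R′ ∷ Rs)) R)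

data MBinary (m : ℕ) : Tree → Set where
  empty   : MBinary m leaf
  combine : ∀ {L} → MBinary m L → (Rs : Vec Tree m) → All (MBinary m) Rs →
            MBinary m (build L Rs)

-- If L lies above comb-(a,m) and R₁, …, Rₘ above comb-(bᵢ,m), then build L (R₁ ∷ … ∷ Rₘ)
-- lies above comb-(1 + a + Σ bᵢ, m): graft the combs into one and rotate their teeth out
-- one at a time. Rotations preserve size, so this comb is comb-(n,m).
-- Conversely, Grouped k 0 holds for comb-(n,m), is preserved by right rotations, and
-- every tree satisfying it is m-binary, by induction on its derivation.
module Submission where

open import Defs
open import Data.Nat using (ℕ; _*_; _≤_)
open import Relation.Binary.PropositionalEquality using (_≡_)
open import Function.Bundles using (_⇔_)

open import Data.Nat using (zero; suc; _+_; _∸_)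
open import Data.Nat.Properties using (+-suc; +-assoc; +-comm; *-cancelʳ-≡)
open import Data.Vec using (Vec; []; _∷_)
open import Data.Vec.Relation.Unary.All using (All; []; _∷_)
open import Data.Product using (∃; _,_)
open import Relation.Binary.PropositionalEquality using (refl; sym; trans; cong; cong₂; subst; module ≡-Reasoning)
open import Relation.Binary.Construct.Closure.ReflexiveTransitive using (ε; _◅_; _◅◅_; gmap; fold)
open import Relation.Binary.Construct.Closure.ReflexiveTransitive.Properties using (module StarReasoning)
open import Function.Bundles using (mk⇔)

node-monoˡ : ∀ {l l′} r → l ≤T l′ → node l r ≤T node l′ r
node-monoˡ r = gmap (λ l → node l r) (left r)

node-monoʳ : ∀ l {r r′} → r ≤T r′ → node l r ≤T node l r′
node-monoʳ l = gmap (node l) (right l)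

graft-⟶ˡ : ∀ {S S′} T → S ⟶ S′ → graft S T ⟶ graft S′ T
graft-⟶ˡ leaf       s = s
graft-⟶ˡ (node l r) s = left r (graft-⟶ˡ l s)

graft-⟶ʳ : ∀ S {T T′} → T ⟶ T′ → graft S T ⟶ graft S T′
graft-⟶ʳ S (rot A B C) = rot (graft S A) B C
graft-⟶ʳ S (left r s)  = left r (graft-⟶ʳ S s)
graft-⟶ʳ S (right l s) = right (graft S l) s

graft-monoˡ : ∀ {S S′} T → S ≤T S′ → graft S T ≤T graft S′ T
graft-monoˡ T = gmap (λ S → graft S T) (graft-⟶ˡ T)

graft-monoʳ : ∀ S {T T′} → T ≤T T′ → graft S T ≤T graft S T′
graft-monoʳ S = gmap (graft S) (graft-⟶ʳ S)

size-⟶ : ∀ {T T′} → T ⟶ T′ → size T ≡ size T′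
size-⟶ (rot A B C) = cong suc (trans (cong suc (+-assoc (size A) (size B) (size C)))
                                     (sym (+-suc (size A) (size B + size C))))
size-⟶ (left r s)  = cong (λ x → suc (x + size r)) (size-⟶ s)
size-⟶ (right l s) = cong (λ x → suc (size l + x)) (size-⟶ s)

size-≤T : ∀ {T T′} → T ≤T T′ → size T ≡ size T′
size-≤T = fold (λ T T′ → size T ≡ size T′) (λ s eq → trans (size-⟶ s) eq) refl

size-chain : ∀ k → size (chain k) ≡ k
size-chain zero    = refl
size-chain (suc k) = cong suc (size-chain k)

size-comb : ∀ n k → size (comb n (suc k)) ≡ n * suc k
size-comb zero    k = refl
size-comb (suc n) k = cong suc (begin
  size (comb n (suc k)) + size (chain k) ≡⟨ cong₂ _+_ (size-comb n k) (size-chain k) ⟩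
  n * suc k + k                          ≡⟨ +-comm (n * suc k) k ⟩
  k + n * suc k                          ∎)
  where open ≡-Reasoning

graft-identityˡ : ∀ T → graft leaf T ≡ T
graft-identityˡ leaf       = refl
graft-identityˡ (node l r) = cong (λ t → node t r) (graft-identityˡ l)

graft-assoc : ∀ S T U → graft (graft S T) U ≡ graft S (graft T U)
graft-assoc S T leaf       = refl
graft-assoc S T (node l r) = cong (λ t → node t r) (graft-assoc S T l)

graft-comb : ∀ a b m → graft (comb a m) (comb b m) ≡ comb (b + a) m
graft-comb a zero    m = refl
graft-comb a (suc b) m = cong (λ t → node t (chain (m ∸ 1))) (graft-comb a b m)

graft-node-≤T : ∀ X S T → graft (node X S) T ≤T node X (graft S T)
graft-node-≤T X S leaf       = ε
graft-node-≤T X S (node l r) = node-monoˡ r (graft-node-≤T X S l) ◅◅ (rot X (graft S l) r ◅ ε)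

AboveComb : ℕ → Tree → Set
AboveComb m T = ∃ λ n → comb n m ≤T T

build-above-graft-comb : ∀ m j L (Rs : Vec Tree (suc j)) → All (AboveComb m) Rs →
  ∃ λ B → graft (node L (chain j)) (comb B m) ≤T build L Rs
build-above-graft-comb m zero L (R ∷ []) ((b , p) ∷ []) = b , (begin
  graft (node L leaf) (comb b m)  ⟶*⟨ graft-node-≤T L leaf (comb b m) ⟩
  node L (graft leaf (comb b m))  ≡⟨ cong (node L) (graft-identityˡ (comb b m)) ⟩
  node L (comb b m)               ⟶*⟨ node-monoʳ L p ⟩
  node L R                        ∎)
  where open StarReasoning _⟶_
build-above-graft-comb m (suc j) L (R ∷ R′ ∷ Rs) ((b , p) ∷ ps)
  with build-above-graft-comb m j leaf (R′ ∷ Rs) ps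
... | B , q = b + B , (begin
  graft (node L (chain (suc j))) (comb (b + B) m)
    ⟶*⟨ graft-node-≤T L (chain (suc j)) (comb (b + B) m) ⟩
  node L (graft (chain (suc j)) (comb (b + B) m))
    ≡⟨ cong (λ t → node L (graft (chain (suc j)) t)) (sym (graft-comb B b m)) ⟩
  node L (graft (chain (suc j)) (graft (comb B m) (comb b m)))
    ≡⟨ cong (node L) (sym (graft-assoc (chain (suc j)) (comb B m) (comb b m))) ⟩
  node L (graft (graft (chain (suc j)) (comb B m)) (comb b m))
    ⟶*⟨ node-monoʳ L (graft-monoˡ (comb b m) q) ⟩
  node L (graft (build leaf (R′ ∷ Rs)) (comb b m))
    ⟶*⟨ node-monoʳ L (graft-monoʳ (build leaf (R′ ∷ Rs)) p) ⟩
  node L (graft (build leaf (R′ ∷ Rs)) R)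
    ∎)
  where open StarReasoning _⟶_

mutual
  mbinary-aboveComb : ∀ {k T} → MBinary (suc k) T → AboveComb (suc k) T
  mbinary-aboveComb empty = 0 , ε
  mbinary-aboveComb {k} (combine {L} mbL Rs mbRs)
    with mbinary-aboveComb mbL | build-above-graft-comb (suc k) k L Rs (all-aboveComb mbRs)
  ... | a , p | B , q = B + suc a , (begin
    comb (B + suc a) (suc k)
      ≡⟨ sym (graft-comb (suc a) B (suc k)) ⟩
    graft (node (comb a (suc k)) (chain k)) (comb B (suc k))
      ⟶*⟨ graft-monoˡ (comb B (suc k)) (node-monoˡ (chain k) p) ⟩
    graft (node L (chain k)) (comb B (suc k))
      ⟶*⟨ q ⟩
    build L Rs
      ∎)
    where open StarReasoning _⟶_

  all-aboveComb : ∀ {k j} {Rs : Vec Tree j} → All (MBinary (suc k)) Rs → All (AboveComb (suc k)) Rs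
  all-aboveComb []         = []
  all-aboveComb (mb ∷ mbs) = mbinary-aboveComb mb ∷ all-aboveComb mbs

buildRight : ∀ {j} → Tree → Vec Tree j → Tree
buildRight R₁ []        = R₁
buildRight R₁ (R₂ ∷ Rs) = graft (build leaf (R₂ ∷ Rs)) R₁

build-∷ : ∀ {j} L R₁ (Rs : Vec Tree j) → build L (R₁ ∷ Rs) ≡ node L (buildRight R₁ Rs)
build-∷ L R₁ []      = refl
build-∷ L R₁ (_ ∷ _) = refl

buildRight-node : ∀ {j} L R (Rs : Vec Tree j) → buildRight (node L R) Rs ≡ node (buildRight L Rs) R
buildRight-node L R []      = refl
buildRight-node L R (_ ∷ _) = refl

module _ (k : ℕ) where

  record Glued (j : ℕ) (T : Tree) : Set where
    constructor glued
    field
      first  : Tree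
      rest   : Vec Tree j
      pieces : All (MBinary (suc k)) (first ∷ rest)
      shape  : T ≡ buildRight first rest

  glued-mbinary : ∀ {T} → Glued 0 T → MBinary (suc k) T
  glued-mbinary (glued R₁ [] (mb ∷ []) refl) = mb

  node-mbinary : ∀ {L R} → MBinary (suc k) L → Glued k R → MBinary (suc k) (node L R)
  node-mbinary {L} mbL (glued R₁ Rs mbs refl) =
    subst (MBinary (suc k)) (build-∷ L R₁ Rs) (combine mbL (R₁ ∷ Rs) mbs)

  cyclicPred : ℕ → ℕ
  cyclicPred zero    = k
  cyclicPred (suc r) = r

  -- Along the path from the root that goes left when possible and right otherwise, the
  -- nodes with empty left child count j down modulo suc k, reaching 0 at the final leaf;
  -- the right subtree of each path node with a left child obeys the same rule from k.
  data Grouped : ℕ → Tree → Set where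
    leaf   : Grouped 0 leaf
    tooth  : ∀ {j R} → Grouped (cyclicPred j) R → Grouped j (node leaf R)
    branch : ∀ {j A B R} → Grouped j (node A B) → Grouped k R → Grouped j (node (node A B) R)

  grouped-node : ∀ {j L R} → Grouped j L → Grouped k R → Grouped j (node L R)
  grouped-node leaf         gR = tooth gR
  grouped-node (tooth g)    gR = branch (tooth g) gR
  grouped-node (branch g h) gR = branch (branch g h) gR

  grouped-⟶ : ∀ {j T T′} → T ⟶ T′ → Grouped j T → Grouped j T′
  grouped-⟶ (rot leaf B C)         (branch (tooth gB) gC)    = tooth (grouped-node gB gC)
  grouped-⟶ (rot (node _ _) B C)   (branch (branch gA gB) gC) = branch gA (grouped-node gB gC)
  grouped-⟶ (left r (rot A B C))   (branch g gr) = branch (grouped-⟶ (rot A B C) g) gr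
  grouped-⟶ (left r (left r′ s))   (branch g gr) = branch (grouped-⟶ (left r′ s) g) gr
  grouped-⟶ (left r (right l s))   (branch g gr) = branch (grouped-⟶ (right l s) g) gr
  grouped-⟶ (right .leaf s)        (tooth g)     = tooth (grouped-⟶ s g)
  grouped-⟶ (right .(node _ _) s)  (branch g gr) = branch g (grouped-⟶ s gr)

  grouped-≤T : ∀ {j T T′} → T ≤T T′ → Grouped j T → Grouped j T′
  grouped-≤T ε        g = g
  grouped-≤T (s ◅ ss) g = grouped-≤T ss (grouped-⟶ s g)

  grouped-chain : ∀ j → Grouped j (chain j)
  grouped-chain zero    = leaf
  grouped-chain (suc j) = tooth (grouped-chain j)

  grouped-comb : ∀ n → Grouped 0 (comb n (suc k))
  grouped-comb zero    = leaf
  grouped-comb (suc n) = grouped-node (grouped-comb n) (grouped-chain k)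

  grouped-glued : ∀ {j T} → Grouped j T → Glued j T
  grouped-glued leaf = glued leaf [] (empty ∷ []) refl
  grouped-glued {zero} (tooth {R = R} g) =
    glued (node leaf R) [] (node-mbinary empty (grouped-glued g) ∷ []) refl
  grouped-glued {suc j} (tooth g) with grouped-glued g
  ... | glued R₁ Rs mbs refl = glued leaf (R₁ ∷ Rs) (empty ∷ mbs) (sym (build-∷ leaf R₁ Rs))
  grouped-glued (branch {R = R} gAB gR) with grouped-glued gAB
  ... | glued R₁ Rs (mb₁ ∷ mbs) eq =
    glued (node R₁ R) Rs (node-mbinary mb₁ (grouped-glued gR) ∷ mbs)
          (trans (cong (λ t → node t R) eq) (sym (buildRight-node R₁ R Rs)))

proposition8p1p6 : (m n : ℕ) → 1 ≤ m → (T : Tree) → size T ≡ n * m →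
    (comb n m ≤T T) ⇔ MBinary m T
proposition8p1p6 (suc k) n _ T size-T = mk⇔ to from
  where
  to : comb n (suc k) ≤T T → MBinary (suc k) T
  to p = glued-mbinary k (grouped-glued k (grouped-≤T k p (grouped-comb k n)))
  from : MBinary (suc k) T → comb n (suc k) ≤T T
  from mb with mbinary-aboveComb mb
  ... | c , p = subst (λ x → comb x (suc k) ≤T T) c≡n p
    where
    c≡n : c ≡ n
    c≡n = *-cancelʳ-≡ c n (suc k) (trans (sym (size-comb c k)) (trans (size-≤T p) size-T))
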